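{- Let $\mathcal{G},\mathcal{H}$ be graph classes such that $\mathcal{G}$ is $k$-cluster rainbow and $\mathcal{H}$ is $\ell$-cluster rainbow. Then $\mathcal{G}\wedge\mathcal{H}$ is $(k+\ell)$-cluster rainbow.
   Context: For vertex-disjoint graphs $H$ and $G$ and $S\subseteq V(G)$, the graph obtained from $G\cup H$ by adding every edge between $S$ and $V(H)$ is said to be obtained from $G$ by taking a join with $H$ along $S$. For a class $\mathcal{H}$, a graph $G'$ is an $\mathcal{H}$-decoration of a graph $G$ if $G'$ is obtained from $G$ by repeatedly taking joins with graphs in $\mathcal{H}$ along cliques of the current graph. For classes $\mathcal{G},\mathcal{H}$, $\mathcal{G}\wedge\mathcal{H}$ is the class of all minors of $\mathcal{H}$-decorations of graphs in $\mathcal{G}$. A colouring has clustering at most $c$ if every connected component of the subgraph induced by each colour class has at most $c$ vertices. A class $\mathcal{G}$ is $k$-cluster rainbow if for every $c$ there exists $G\in\mathcal{G}$ such that every colouring of $G$ with clustering at most $c$ contains a rainbow clique of size $k$ (a clique whose vertices receive pairwise distinct colours). -}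

module Defs where

open import Data.Nat using (ℕ; _+_; _≤_)
open import Data.Fin using (Fin; splitAt)
open import Data.Bool using (Bool; true; false)
open import Data.Sum using (_⊎_; inj₁; inj₂)
open import Data.Maybe using (Maybe; just)
open import Data.Product using (Σ; ∃; _×_; _,_)
open import Data.List using (List; length)
open import Data.List.Relation.Unary.All using (All)
open import Data.List.Relation.Unary.Unique.Propositional using (Unique)
open import Relation.Binary.PropositionalEquality using (_≡_; _≢_; refl)
open import Function.Definitions using (Injective)

record Graph : Set where
  field
    n     : ℕ
    adj   : Fin n → Fin n → Bool
    sym   : ∀ u v → adj u v ≡ adj v u
    irref : ∀ v → adj v v ≡ false
open Graph public

GraphClass : Set₁
GraphClass = Graph → Set

Subset : ℕ → Set
Subset n = Fin n → Bool

IsClique : (G : Graph) → Subset (n G) → Set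
IsClique G S = ∀ u v → S u ≡ true → S v ≡ true → u ≢ v → adj G u v ≡ true

-- Join of G with H along S ⊆ V(G); vertex set Fin (n G + n H),
-- first n G vertices are those of G, the rest those of H.
module _ (G H : Graph) (S : Subset (n G)) where
  jadj : Fin (n G) ⊎ Fin (n H) → Fin (n G) ⊎ Fin (n H) → Bool
  jadj (inj₁ u) (inj₁ v) = adj G u v
  jadj (inj₂ u) (inj₂ v) = adj H u v
  jadj (inj₁ u) (inj₂ v) = S u
  jadj (inj₂ u) (inj₁ v) = S v

  jsym : ∀ x y → jadj x y ≡ jadj y x
  jsym (inj₁ u) (inj₁ v) = sym G u v
  jsym (inj₂ u) (inj₂ v) = sym H u v
  jsym (inj₁ u) (inj₂ v) = refl
  jsym (inj₂ u) (inj₁ v) = refl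

  jirr : ∀ x → jadj x x ≡ false
  jirr (inj₁ u) = irref G u
  jirr (inj₂ u) = irref H u

  join : Graph
  join = record
    { n = n G + n H
    ; adj = λ u v → jadj (splitAt (n G) u) (splitAt (n G) v)
    ; sym = λ u v → jsym (splitAt (n G) u) (splitAt (n G) v)
    ; irref = λ u → jirr (splitAt (n G) u)
    }

data Decoration (𝓗 : GraphClass) (G : Graph) : Graph → Set where
  done : Decoration 𝓗 G G
  step : ∀ {G'} → Decoration 𝓗 G G' → (H : Graph) → 𝓗 H →
         (S : Subset (n G')) → IsClique G' S → Decoration 𝓗 G (join G' H S)

data ReachIn (G : Graph) (P : Fin (n G) → Set) (u : Fin (n G)) : Fin (n G) → Set where
  here : P u → ReachIn G P u u
  step : ∀ {v w} → ReachIn G P u v → adj G v w ≡ true → P w → ReachIn G P u w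

-- F is a minor of G: a model with branch sets φ⁻¹(i), which are
-- automatically disjoint, nonempty, connected, and adjacent whenever i ~ j in F.
record Minor (F G : Graph) : Set where
  field
    φ         : Fin (n G) → Maybe (Fin (n F))
    nonempty  : ∀ i → ∃ λ u → φ u ≡ just i
    connected : ∀ i u v → φ u ≡ just i → φ v ≡ just i →
                ReachIn G (λ w → φ w ≡ just i) u v
    edges     : ∀ i j → adj F i j ≡ true →
                Σ (Fin (n G)) λ u → Σ (Fin (n G)) λ v →
                  (φ u ≡ just i) × (φ v ≡ just j) × (adj G u v ≡ true)

_∧_ : GraphClass → GraphClass → GraphClass
(𝓖 ∧ 𝓗) F = Σ Graph λ G → 𝓖 G × Σ Graph λ G' → Decoration 𝓗 G G' × Minor F G'

Colouring : Graph → Set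
Colouring G = Fin (n G) → ℕ

-- Every monochromatic component has at most c vertices: for every vertex v,
-- any list of distinct vertices reachable from v inside v's colour class has length ≤ c.
ClusteringAtMost : (G : Graph) → Colouring G → ℕ → Set
ClusteringAtMost G col c =
  ∀ v (xs : List (Fin (n G))) → Unique xs →
    All (ReachIn G (λ w → col w ≡ col v) v) xs → length xs ≤ c

HasRainbowClique : (G : Graph) → Colouring G → ℕ → Set
HasRainbowClique G col k =
  Σ (Fin k → Fin (n G)) λ f →
    (∀ i j → i ≢ j → adj G (f i) (f j) ≡ true) ×
    Injective _≡_ _≡_ (λ i → col (f i))

ClusterRainbow : ℕ → GraphClass → Set
ClusterRainbow k 𝓖 =
  ∀ c → Σ Graph λ G → 𝓖 G ×
    (∀ (col : Colouring G) → ClusteringAtMost G col c → HasRainbowClique G col k)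

module Submission where

-- Fix c, take G ∈ 𝓖 and H ∈ 𝓗 witnessing the hypotheses for c, and let
-- r = k·c + 1.  Decorate G by joining r fresh copies of H along every clique
-- of G; call the result F (it lies in 𝓖 ∧ 𝓗 as its own minor).  Given a
-- colouring of F with clustering at most c, its restriction to G contains a
-- rainbow k-clique K.  Some copy of H joined along the vertex set of K
-- avoids all k colours of K: otherwise, by the pigeonhole principle, more than
-- c copies each contain a vertex of the same colour as one vertex w of K, and
-- these vertices together with w lie in one monochromatic component.  A
-- rainbow ℓ-clique of that copy of H together with K is a rainbow
-- (k + ℓ)-clique of F.

open import Defs hiding (sym)
open import Data.Nat as ℕ using (ℕ; zero; suc; _+_; _*_; _≤_; _<_; _<?_)
open import Data.Nat.Properties using (+-suc; +-cancelˡ-<; +-monoˡ-≤; <⇒≱; ≮⇒≥; n<1+n; module ≤-Reasoning)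
open import Data.Fin using (Fin; zero; suc; splitAt; _↑ˡ_; _↑ʳ_; _≟_)
open import Data.Fin.Properties using (any?; all?; splitAt-↑ˡ; splitAt-↑ʳ; ↑ˡ-injective; ↑ʳ-injective; join-splitAt)
import Data.Fin as Fin
open import Data.Bool using (Bool; true; false)
import Data.Bool.Properties as Bool
open import Data.Sum using (_⊎_; inj₁; inj₂; [_,_])
open import Data.Maybe using (just)
open import Data.Product using (Σ; ∃; _×_; _,_; proj₁; proj₂)
open import Data.Empty using (⊥-elim)
open import Data.List using (List; []; _∷_; map; _++_; length; filter; allFin)
open import Data.List.Properties using (length-map; length-tabulate)
open import Data.List.Membership.Propositional using (_∈_)
open import Data.List.Membership.Propositional.Properties using (∈-map⁺; ∈-++⁺ˡ; ∈-++⁺ʳ; ∈-allFin)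
open import Data.List.Relation.Unary.Any using (here; there)
import Data.List.Relation.Unary.Any as Any
open import Data.List.Relation.Unary.All using (All; []; _∷_)
import Data.List.Relation.Unary.All as All
import Data.List.Relation.Unary.All.Properties as All
open import Data.List.Relation.Unary.Unique.Propositional using (Unique)
import Data.List.Relation.Unary.Unique.Propositional.Properties as Unique
open import Data.Vec using (Vec; lookup; tabulate)
import Data.Vec as Vec
open import Data.Vec.Properties using (lookup∘tabulate)
open import Function using (_∘_)
open import Function.Definitions using (Injective)
open import Relation.Nullary using (¬_; Dec; yes; no; does; ¬?; _×-dec_; _→-dec_)
open import Relation.Nullary.Decidable using (dec-true; decidable-stable)
open import Relation.Unary using (Decidable)
open import Relation.Unary.Properties using (∁?)
open import Relation.Binary.Definitions using (DecidableEquality)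
open import Relation.Binary.PropositionalEquality using (_≡_; _≢_; refl; sym; trans; cong; cong₂; subst; subst₂; _≗_)

does-true : ∀ {P : Set} (P? : Dec P) → does P? ≡ true → P
does-true (yes p) _ = p
does-true (no _)  ()

record Embedding (A B : Graph) : Set where
  field
    emb       : Fin (n A) → Fin (n B)
    preserves : ∀ x y → adj B (emb x) (emb y) ≡ adj A x y
    injective : ∀ {x y} → emb x ≡ emb y → x ≡ y
open Embedding

id-emb : (A : Graph) → Embedding A A
id-emb A = record { emb = λ x → x ; preserves = λ _ _ → refl ; injective = λ eq → eq }

-- Composition, written in diagrammatic order.
_⨾_ : ∀ {A B C} → Embedding A B → Embedding B C → Embedding A C
E ⨾ X = record
  { emb       = emb X ∘ emb E
  ; preserves = λ x y → trans (preserves X _ _) (preserves E x y)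
  ; injective = injective E ∘ injective X
  }

module _ (D H : Graph) (S : Subset (n D)) where

  inl : Embedding D (join D H S)
  inl = record
    { emb       = _↑ˡ n H
    ; preserves = λ x y → cong₂ (jadj D H S) (splitAt-↑ˡ (n D) x (n H)) (splitAt-↑ˡ (n D) y (n H))
    ; injective = ↑ˡ-injective (n H) _ _
    }

  inr : Embedding H (join D H S)
  inr = record
    { emb       = n D ↑ʳ_
    ; preserves = λ x y → cong₂ (jadj D H S) (splitAt-↑ʳ (n D) (n H) x) (splitAt-↑ʳ (n D) (n H) y)
    ; injective = ↑ʳ-injective (n D) _ _
    }

  inl-inr-adjacent : ∀ x y → adj (join D H S) (emb inl x) (emb inr y) ≡ S x
  inl-inr-adjacent x y = cong₂ (jadj D H S) (splitAt-↑ˡ (n D) x (n H)) (splitAt-↑ʳ (n D) (n H) y)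

  inl-inr-disjoint : ∀ x y → emb inl x ≢ emb inr y
  inl-inr-disjoint x y eq
    with () ← trans (sym (splitAt-↑ˡ (n D) x (n H))) (trans (cong (splitAt (n D)) eq) (splitAt-↑ʳ (n D) (n H) y))

module _ {𝓗 : GraphClass} where

  _++ᵈ_ : ∀ {A B C} → Decoration 𝓗 A B → Decoration 𝓗 B C → Decoration 𝓗 A C
  d ++ᵈ done               = d
  d ++ᵈ step e H H∈ S S-cl = step (d ++ᵈ e) H H∈ S S-cl

  decoration-embedding : ∀ {A B} → Decoration 𝓗 A B → Embedding A B
  decoration-embedding {A} done           = id-emb A
  decoration-embedding (step {D} d H _ S _) = decoration-embedding d ⨾ inl D H S

module _ {a b : ℕ} (h : Fin a → Fin b) (T : Subset a) where

  image? : ∀ y → Dec (∃ λ x → T x ≡ true × h x ≡ y)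
  image? y = any? λ x → (T x Bool.≟ true) ×-dec (h x ≟ y)

  image : Subset b
  image y = does (image? y)

  image-∋ : ∀ {x} → T x ≡ true → image (h x) ≡ true
  image-∋ {x} Tx = dec-true (image? (h x)) (x , Tx , refl)

image-clique : ∀ (B : Graph) {a} (h : Fin a → Fin (n B)) T →
  (∀ x x' → T x ≡ true → T x' ≡ true → h x ≢ h x' → adj B (h x) (h x') ≡ true) →
  IsClique B (image h T)
image-clique B h T adjacent u v u∈ v∈ u≢v
  with x , Tx , refl ← does-true (image? h T u) u∈
     | x' , Tx' , refl ← does-true (image? h T v) v∈
  = adjacent x x' Tx Tx' u≢v

vertex-set : ∀ {k b} → (Fin k → Fin b) → Subset b
vertex-set f = image f (λ _ → true)

vertex-set-∋ : ∀ {k b} (f : Fin k → Fin b) i → vertex-set f (f i) ≡ true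
vertex-set-∋ f i = image-∋ f _ refl

vertex-set-clique : ∀ G {k} (f : Fin k → Fin (n G)) → (∀ i j → i ≢ j → adj G (f i) (f j) ≡ true) →
                    IsClique G (vertex-set f)
vertex-set-clique G f clique = image-clique G f _ λ i j _ _ fi≢fj → clique i j (fi≢fj ∘ cong f)

embedded-clique : ∀ {A B} (E : Embedding A B) {T} → IsClique A T → IsClique B (image (emb E) T)
embedded-clique {B = B} E T-cl = image-clique B (emb E) _ λ x x' Tx Tx' Ex≢Ex' →
  trans (preserves E x x') (T-cl x x' Tx Tx' (Ex≢Ex' ∘ cong (emb E)))

-- Being a clique is decidable; decorations may only join along cliques.
isClique? : ∀ G (T : Subset (n G)) → Dec (IsClique G T)
isClique? G T = all? λ u → all? λ v →
  (T u Bool.≟ true) →-dec (T v Bool.≟ true) →-dec ¬? (u ≟ v) →-dec (adj G u v Bool.≟ true)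

module _ {G H : Graph} where

  record Copies (r : ℕ) (F : Graph) (ι : Fin (n G) → Fin (n F)) (T : Subset (n G)) : Set where
    field
      copy     : Fin r → Embedding H F
      attached : ∀ j u y → T u ≡ true → adj F (ι u) (emb (copy j) y) ≡ true
      disjoint : ∀ {j j'} y y' → emb (copy j) y ≡ emb (copy j') y' → j ≡ j'
  open Copies public

  no-copies : ∀ {F} {ι : Fin (n G) → Fin (n F)} {T} → Copies 0 F ι T
  no-copies = record { copy = λ () ; attached = λ () ; disjoint = λ { {()} } }

  copies-⨾ : ∀ {r F F' ι T} → Copies r F ι T → (X : Embedding F F') → Copies r F' (emb X ∘ ι) T
  copies-⨾ cps X = record
    { copy     = λ j → copy cps j ⨾ X
    ; attached = λ j u y Tu → trans (preserves X _ _) (attached cps j u y Tu)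
    ; disjoint = λ y y' eq → disjoint cps y y' (injective X eq)
    }

  copies-resp-≗ : ∀ {r F} {ι : Fin (n G) → Fin (n F)} {T T'} → T ≗ T' → Copies r F ι T → Copies r F ι T'
  copies-resp-≗ T≗T' cps = record
    { copy     = copy cps
    ; attached = λ j u y T'u → attached cps j u y (trans (T≗T' u) T'u)
    ; disjoint = disjoint cps
    }

  add-copy : ∀ {r D} (E : Embedding G D) {T} → Copies r D (emb E) T →
             Copies (suc r) (join D H (image (emb E) T)) (emb (E ⨾ inl D H (image (emb E) T))) T
  add-copy {r} {D} E {T} cps = record { copy = new ; attached = new-attached ; disjoint = new-disjoint }
    where
    S : Subset (n D)
    S = image (emb E) T

    old : Copies r (join D H S) (emb (inl D H S) ∘ emb E) T
    old = copies-⨾ cps (inl D H S)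

    new : Fin (suc r) → Embedding H (join D H S)
    new zero    = inr D H S
    new (suc j) = copy old j

    new-attached : ∀ j u y → T u ≡ true → adj (join D H S) (emb (inl D H S) (emb E u)) (emb (new j) y) ≡ true
    new-attached zero    u y Tu = trans (inl-inr-adjacent D H S (emb E u) y) (image-∋ (emb E) T Tu)
    new-attached (suc j)        = attached old j

    new-disjoint : ∀ {j j'} y y' → emb (new j) y ≡ emb (new j') y' → j ≡ j'
    new-disjoint {zero}  {zero}   _ _  _  = refl
    new-disjoint {zero}  {suc _}  y y' eq = ⊥-elim (inl-inr-disjoint D H S _ y (sym eq))
    new-disjoint {suc _} {zero}   y y' eq = ⊥-elim (inl-inr-disjoint D H S _ y' eq)
    new-disjoint {suc _} {suc _}  y y' eq = cong suc (disjoint old y y' eq)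

  module _ {𝓗 : GraphClass} (H∈ : 𝓗 H) where

    attach-copies : ∀ r {D} (E : Embedding G D) {T} → IsClique G T →
                    Σ Graph λ D' → Σ (Decoration 𝓗 D D') λ d → Copies r D' (emb (E ⨾ decoration-embedding d)) T
    attach-copies zero    E T-cl = _ , done , no-copies
    attach-copies (suc r) E T-cl with D' , d , cps ← attach-copies r E T-cl =
      _ , step d H H∈ _ (embedded-clique (E ⨾ decoration-embedding d) T-cl) ,
      add-copy (E ⨾ decoration-embedding d) cps

    record Saturation (r : ℕ) (listed : Vec Bool (n G) → Set) : Set where
      field
        F          : Graph
        decoration : Decoration 𝓗 G F
        base       : Embedding G F
        copies     : ∀ {v} → listed v → IsClique G (lookup v) → Copies r F (emb base) (lookup v)

    saturation-∷ : ∀ {r vs} v → Saturation r (_∈ vs) → Saturation r (_∈ v ∷ vs)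
    saturation-∷ v S with isClique? G (lookup v)
    ... | no ¬clique = record
      { F          = Saturation.F S
      ; decoration = Saturation.decoration S
      ; base       = Saturation.base S
      ; copies     = λ { (here refl) clique → ⊥-elim (¬clique clique) ; (there v∈) → Saturation.copies S v∈ }
      }
    ... | yes clique with D' , d , cps ← attach-copies _ (Saturation.base S) clique = record
      { F          = D'
      ; decoration = Saturation.decoration S ++ᵈ d
      ; base       = Saturation.base S ⨾ decoration-embedding d
      ; copies     = λ { (here refl) _ → cps
                       ; (there v∈) clique' → copies-⨾ (Saturation.copies S v∈ clique') (decoration-embedding d) }
      }

    saturate : ∀ r (vs : List (Vec Bool (n G))) → Saturation r (_∈ vs)
    saturate r []       = record { F = G ; decoration = done ; base = id-emb G ; copies = λ () }
    saturate r (v ∷ vs) = saturation-∷ v (saturate r vs)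

boolean-vectors : ∀ m → List (Vec Bool m)
boolean-vectors zero    = Vec.[] ∷ []
boolean-vectors (suc m) = map (true Vec.∷_) (boolean-vectors m) ++ map (false Vec.∷_) (boolean-vectors m)

∈-boolean-vectors : ∀ {m} (v : Vec Bool m) → v ∈ boolean-vectors m
∈-boolean-vectors Vec.[]          = here refl
∈-boolean-vectors (true Vec.∷ v)  = ∈-++⁺ˡ (∈-map⁺ (true Vec.∷_) (∈-boolean-vectors v))
∈-boolean-vectors (false Vec.∷ v) = ∈-++⁺ʳ _ (∈-map⁺ (false Vec.∷_) (∈-boolean-vectors v))

copies-along-every-clique : ∀ {𝓗 : GraphClass} {G H : Graph} {r : ℕ} {H∈ : 𝓗 H}
  (S : Saturation {G} {H} {𝓗} H∈ r (_∈ boolean-vectors (n G))) →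
  ∀ T → IsClique G T → Copies {G} {H} r (Saturation.F S) (emb (Saturation.base S)) T
copies-along-every-clique S T T-cl =
  copies-resp-≗ (lookup∘tabulate T)
    (Saturation.copies S (∈-boolean-vectors (tabulate T))
      λ u v u∈ v∈ → T-cl u v (trans (sym (lookup∘tabulate T u)) u∈) (trans (sym (lookup∘tabulate T v)) v∈))

walk-image : ∀ {A B} (E : Embedding A B) (col : Colouring B) {v w} →
  ReachIn A (λ x → col (emb E x) ≡ col (emb E v)) v w →
  ReachIn B (λ x → col x ≡ col (emb E v)) (emb E v) (emb E w)
walk-image E col (here same)        = here same
walk-image E col (step walk a same) = step (walk-image E col walk) (trans (preserves E _ _) a) same

clustering-restrict : ∀ {A B} (E : Embedding A B) (col : Colouring B) {c} →
  ClusteringAtMost B col c → ClusteringAtMost A (col ∘ emb E) c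
clustering-restrict E col {c} clustered v xs unique walks =
  subst (_≤ c) (length-map (emb E) xs)
    (clustered (emb E v) (map (emb E) xs) (Unique.map⁺ (injective E) unique)
      (All.map⁺ (All.map (walk-image E col) walks)))

length-filter-∁ : ∀ {A : Set} {P : A → Set} (P? : Decidable P) (xs : List A) →
  length (filter P? xs) + length (filter (∁? P?) xs) ≡ length xs
length-filter-∁ P? []       = refl
length-filter-∁ P? (x ∷ xs) with P? x
... | yes _ = cong suc (length-filter-∁ P? xs)
... | no  _ = trans (+-suc _ _) (cong suc (length-filter-∁ P? xs))

module _ {A B : Set} (_≟ᴮ_ : DecidableEquality B) (q : A → B) (c : ℕ) where

  fibre? : ∀ b → Decidable (λ x → q x ≡ b)
  fibre? b x = q x ≟ᴮ b

  pigeonhole : ∀ bs xs → Unique xs → All (λ x → q x ∈ bs) xs → length bs * c < length xs →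
               ∃ λ b → ∃ λ ys → Unique ys × All (λ y → q y ≡ b) ys × c < length ys
  pigeonhole []       []       _      _            ()
  pigeonhole []       (x ∷ xs) _      (() ∷ _)     _
  pigeonhole (b ∷ bs) xs       unique values more with c <? length (filter (fibre? b) xs)
  ... | yes large = b , _ , Unique.filter⁺ (fibre? b) unique , All.all-filter (fibre? b) xs , large
  ... | no  small = pigeonhole bs rest (Unique.filter⁺ (∁? (fibre? b)) unique) rest-values rest-more
    where
    rest : List A
    rest = filter (∁? (fibre? b)) xs

    rest-values : All (λ x → q x ∈ bs) rest
    rest-values = All.zipWith (λ (q∈ , ≢b) → Any.tail ≢b q∈)
                    (All.filter⁺ (∁? (fibre? b)) values , All.all-filter (∁? (fibre? b)) xs)

    rest-more : length bs * c < length rest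
    rest-more = +-cancelˡ-< c _ _ (begin-strict
      c + length bs * c                               <⟨ more ⟩
      length xs                                       ≡⟨ sym (length-filter-∁ (fibre? b) xs) ⟩
      length (filter (fibre? b) xs) + length rest     ≤⟨ +-monoˡ-≤ (length rest) (≮⇒≥ small) ⟩
      c + length rest                                 ∎)
      where open ≤-Reasoning

fibre-pigeonhole : ∀ {r k} c (q : Fin r → Fin k) → k * c < r →
  ∃ λ i → ∃ λ js → Unique js × All (λ j → q j ≡ i) js × c < length js
fibre-pigeonhole {r} {k} c q more =
  pigeonhole _≟_ q c (allFin k) (allFin r) (Unique.allFin⁺ r)
    (All.tabulate⁺ λ j → ∈-allFin (q j))
    (subst₂ (λ a b → a * c < b) (sym (length-tabulate {n = k} _)) (sym (length-tabulate {n = r} _)) more)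

module _ {G H F : Graph} (col : Colouring F) {c : ℕ} (clustered : ClusteringAtMost F col c)
         {r k ι T} (cps : Copies {G} {H} r F ι T) (f : Fin k → Fin (n G)) (f∈T : ∀ i → T (f i) ≡ true) where

  Clash : Fin r → Set
  Clash j = ∃ λ y → ∃ λ i → col (emb (copy cps j) y) ≡ col (ι (f i))

  clash? : ∀ j → Dec (Clash j)
  clash? j = any? λ y → any? λ i → col (emb (copy cps j) y) ℕ.≟ col (ι (f i))

  -- If more than k·c copies all clash, then by pigeonhole more than c of
  -- them clash with the same f i, and their clashing vertices lie in the
  -- monochromatic component of ι (f i), which is then too large.
  all-clash-impossible : k * c < r → ¬ (∀ j → Clash j)
  all-clash-impossible more clash
    with i , js , distinct , same-index , large ← fibre-pigeonhole c (proj₁ ∘ proj₂ ∘ clash) more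
    = <⇒≱ large (subst (_≤ c) (length-map vertex js)
        (clustered (ι (f i)) (map vertex js) (Unique.map⁺ (disjoint cps _ _) distinct)
          (All.map⁺ (All.map walk same-index))))
    where
    vertex : Fin r → Fin (n F)
    vertex j = emb (copy cps j) (proj₁ (clash j))

    walk : ∀ {j} → proj₁ (proj₂ (clash j)) ≡ i → ReachIn F (λ x → col x ≡ col (ι (f i))) (ι (f i)) (vertex j)
    walk {j} refl = step (here refl) (attached cps j (f i) _ (f∈T i)) (proj₂ (proj₂ (clash j)))

  avoiding-copy : k * c < r → ∃ λ j → ∀ y i → col (emb (copy cps j) y) ≢ col (ι (f i))
  avoiding-copy more with any? (λ j → ¬? (clash? j))
  ... | yes (j , ¬clash) = j , λ y i same → ¬clash (y , i , same)
  ... | no  none         = ⊥-elim (all-clash-impossible more λ j →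
                             decidable-stable (clash? j) λ ¬clash → none (j , ¬clash))

IsRainbowClique : ∀ (G : Graph) (col : Colouring G) {k} → (Fin k → Fin (n G)) → Set
IsRainbowClique G col f = (∀ i j → i ≢ j → adj G (f i) (f j) ≡ true) × Injective _≡_ _≡_ (col ∘ f)

rainbow-image : ∀ {A B k} (E : Embedding A B) (col : Colouring B) {f : Fin k → Fin (n A)} →
  IsRainbowClique A (col ∘ emb E) f → IsRainbowClique B col (emb E ∘ f)
rainbow-image E col (clique , rainbow) = (λ i j i≢j → trans (preserves E _ _) (clique i j i≢j)) , rainbow

splitAt-injective : ∀ k {ℓ} {x y : Fin (k + ℓ)} → splitAt k x ≡ splitAt k y → x ≡ y
splitAt-injective k {ℓ} {x} {y} eq =
  trans (sym (join-splitAt k ℓ x)) (trans (cong (Fin.join k ℓ) eq) (join-splitAt k ℓ y))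

rainbow-union : ∀ {F} {col : Colouring F} {k ℓ} (f : Fin k → Fin (n F)) (g : Fin ℓ → Fin (n F)) →
  IsRainbowClique F col f → IsRainbowClique F col g →
  (∀ i i' → adj F (f i) (g i') ≡ true) → (∀ i i' → col (f i) ≢ col (g i')) →
  HasRainbowClique F col (k + ℓ)
rainbow-union {F} {col} {k} {ℓ} f g (f-clique , f-rainbow) (g-clique , g-rainbow) joined apart =
  fg ∘ splitAt k ,
  (λ x y x≢y → clique (splitAt k x) (splitAt k y) (x≢y ∘ splitAt-injective k)) ,
  (λ same → splitAt-injective k (rainbow _ _ same))
  where
  fg : Fin k ⊎ Fin ℓ → Fin (n F)
  fg = [ f , g ]

  clique : ∀ a b → a ≢ b → adj F (fg a) (fg b) ≡ true
  clique (inj₁ i) (inj₁ j) a≢b = f-clique i j (a≢b ∘ cong inj₁)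
  clique (inj₂ i) (inj₂ j) a≢b = g-clique i j (a≢b ∘ cong inj₂)
  clique (inj₁ i) (inj₂ j) _   = joined i j
  clique (inj₂ i) (inj₁ j) _   = trans (Graph.sym F _ _) (joined j i)

  rainbow : ∀ a b → col (fg a) ≡ col (fg b) → a ≡ b
  rainbow (inj₁ i) (inj₁ j) same = cong inj₁ (f-rainbow same)
  rainbow (inj₂ i) (inj₂ j) same = cong inj₂ (g-rainbow same)
  rainbow (inj₁ i) (inj₂ j) same = ⊥-elim (apart i j same)
  rainbow (inj₂ i) (inj₁ j) same = ⊥-elim (apart j i (sym same))

minor-refl : ∀ F → Minor F F
minor-refl F = record
  { φ         = just
  ; nonempty  = λ i → i , refl
  ; connected = λ { i u v refl refl → here refl }
  ; edges     = λ i j ij → i , j , refl , refl , ij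
  }

module _ {𝓗 : GraphClass} {G H : Graph} {H∈ : 𝓗 H} {k ℓ c : ℕ}
         (rainbow-G : ∀ col → ClusteringAtMost G col c → HasRainbowClique G col k)
         (rainbow-H : ∀ col → ClusteringAtMost H col c → HasRainbowClique H col ℓ)
         (S : Saturation {G} {H} {𝓗} H∈ (suc (k * c)) (_∈ boolean-vectors (n G))) where
  open Saturation S using (F; base)

  saturation-rainbow : ∀ col → ClusteringAtMost F col c → HasRainbowClique F col (k + ℓ)
  saturation-rainbow col clustered
    with f , f-rainbow ← rainbow-G (col ∘ emb base) (clustering-restrict base col clustered)
    with cps ← copies-along-every-clique S (vertex-set f) (vertex-set-clique G f (proj₁ f-rainbow))
    with j , avoids ← avoiding-copy col clustered cps f (vertex-set-∋ f) (n<1+n (k * c))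
    with g , g-rainbow ← rainbow-H (col ∘ emb (copy cps j)) (clustering-restrict (copy cps j) col clustered)
    = rainbow-union {F} {col} (emb base ∘ f) (emb (copy cps j) ∘ g)
        (rainbow-image base col f-rainbow) (rainbow-image (copy cps j) col g-rainbow)
        (λ i i' → attached cps j (f i) (g i') (vertex-set-∋ f i))
        (λ i i' same → avoids (g i') i (sym same))

lemma31 : (k ℓ : ℕ) (𝓖 𝓗 : GraphClass) →
    ClusterRainbow k 𝓖 → ClusterRainbow ℓ 𝓗 → ClusterRainbow (k + ℓ) (𝓖 ∧ 𝓗)
lemma31 k ℓ 𝓖 𝓗 rainbow-𝓖 rainbow-𝓗 c
  with G , G∈ , rainbow-G ← rainbow-𝓖 c
     | H , H∈ , rainbow-H ← rainbow-𝓗 c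
  = F , (G , G∈ , F , decoration , minor-refl F) , saturation-rainbow rainbow-G rainbow-H S
  where
  S : Saturation H∈ (suc (k * c)) (_∈ boolean-vectors (n G))
  S = saturate {G} {H} {𝓗} H∈ (suc (k * c)) (boolean-vectors (n G))
  open Saturation S using (F; decoration)
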